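{- Let $G=(V,E)$ be a graph on $n$ vertices satisfying the following three properties: (1) for every set $S\subseteq V$ of at most $\frac{1}{2000}\log_2 n$ vertices, there are more than $n^{0.999}\log_2 n$ vertices in $V\setminus S$ not adjacent to any vertex of $S$; (2) for every set $Y\subseteq V$ with $|Y|=y\ge n^{0.999}$, the number of vertices in $V\setminus Y$ having at most $0.41y$ non-neighbors in $Y$ is smaller than $\frac14\log_2 n$; (3) every significant set $Y$ in $G$ contains a clique $K$ of size $1.9\log_2 n$ such that every vertex $v\in V\setminus Y$ has at least one non-neighbor in $K$. Then $\chi_c(G)>\frac{1}{2000}\log_2 n$.
   Context: All logarithms are base $2$; floors and ceilings are omitted. A clique is maximal if it is not properly contained in a larger clique. A clique coloring of $G$ is a vertex coloring such that no maximal clique with at least two vertices is monochromatic; $\chi_c(G)$ is the minimum number of colors in a clique coloring of $G$. For an $n$-vertex graph $G=(V,E)$, a set $Y\subsetneq V$ with $|Y|=y$ is called significant if (i) every vertex $v\in V\setminus Y$ has at least $n^{0.999}$ non-neighbors in $Y$, and (ii) the number of vertices $v\in V\setminus Y$ that have at most $0.41y$ non-neighbors in $Y$ is at most $\frac14\log_2 n$. -}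

module Defs where

open import Data.Nat using (ℕ; _+_; _*_; _^_; _≤_; _<_; _≤ᵇ_; _≡ᵇ_)
open import Data.Bool using (Bool; true; false; not; _∧_)
open import Data.Fin using (Fin)
open import Data.Fin.Subset using (Subset; _∈_; _∉_; _⊆_; ∣_∣)
open import Data.Vec using (lookup; tabulate)
open import Data.Product using (Σ; ∃; _×_)
open import Relation.Binary.PropositionalEquality using (_≡_; _≢_)

record Graph (n : ℕ) : Set where
  field
    adj    : Fin n → Fin n → Bool
    sym    : ∀ u v → adj u v ≡ adj v u
    irrefl : ∀ v → adj v v ≡ false
open Graph public

countWhere : {n : ℕ} → (Fin n → Bool) → ℕ
countWhere f = ∣ tabulate f ∣

nonNbrsIn : {n : ℕ} → Graph n → Subset n → Fin n → ℕ
nonNbrsIn G Y v = countWhere (λ u → lookup Y u ∧ not (adj G v u))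

nbrsIn : {n : ℕ} → Graph n → Subset n → Fin n → ℕ
nbrsIn G S v = countWhere (λ u → lookup S u ∧ adj G v u)

IsClique : {n : ℕ} → Graph n → Subset n → Set
IsClique G K = ∀ u v → u ∈ K → v ∈ K → u ≢ v → adj G u v ≡ true

IsMaximalClique : {n : ℕ} → Graph n → Subset n → Set
IsMaximalClique G K = IsClique G K × (∀ K′ → IsClique G K′ → K ⊆ K′ → K′ ⊆ K)

IsCliqueColoring : {n k : ℕ} → Graph n → (Fin n → Fin k) → Set
IsCliqueColoring G c =
  ∀ K → IsMaximalClique G K → 2 ≤ ∣ K ∣ →
  Σ _ λ u → Σ _ λ v → u ∈ K × v ∈ K × c u ≢ c v

-- Exact natural-number encodings of real comparisons (n ≥ 1):
--   m > n^{0.999} · log₂ n   ⇔  ∃ rational a/b with log₂ n < a/b < m / n^{0.999}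
--                            ⇔  ∃ a b, b ≥ 1, n^b < 2^a, a^1000 · n^999 < m^1000 · b^1000
MoreThanN999LogN : ℕ → ℕ → Set
MoreThanN999LogN n m =
  Σ ℕ λ a → Σ ℕ λ b → 1 ≤ b × n ^ b < 2 ^ a × a ^ 1000 * n ^ 999 < m ^ 1000 * b ^ 1000

-- Property (1): |S| ≤ (1/2000) log₂ n  ⇔  2^(2000|S|) ≤ n
Property1 : {n : ℕ} → Graph n → Set
Property1 {n} G =
  ∀ (S : Subset n) → 2 ^ (2000 * ∣ S ∣) ≤ n →
  MoreThanN999LogN n (countWhere (λ v → not (lookup S v) ∧ (nbrsIn G S v ≡ᵇ 0)))

fewNonNbrCount : {n : ℕ} → Graph n → Subset n → ℕ
fewNonNbrCount G Y =
  countWhere (λ v → not (lookup Y v) ∧ (100 * nonNbrsIn G Y v ≤ᵇ 41 * ∣ Y ∣))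

-- Property (2): |Y| ≥ n^{0.999} ⇔ n^999 ≤ |Y|^1000 ;  count < (1/4) log₂ n ⇔ 2^(4 count) < n
Property2 : {n : ℕ} → Graph n → Set
Property2 {n} G =
  ∀ (Y : Subset n) → n ^ 999 ≤ ∣ Y ∣ ^ 1000 → 2 ^ (4 * fewNonNbrCount G Y) < n

Significant : {n : ℕ} → Graph n → Subset n → Set
Significant {n} G Y =
  (Σ (Fin n) λ v → v ∉ Y) ×
  (∀ v → v ∉ Y → n ^ 999 ≤ nonNbrsIn G Y v ^ 1000) ×
  2 ^ (4 * fewNonNbrCount G Y) ≤ n

-- Property (3): clique K ⊆ Y with |K| ≥ 1.9 log₂ n (⇔ n^19 ≤ 2^(10|K|)),
-- every vertex outside Y has a non-neighbour in K
Property3 : {n : ℕ} → Graph n → Set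
Property3 {n} G =
  ∀ (Y : Subset n) → Significant G Y →
  Σ (Subset n) λ K → K ⊆ Y × IsClique G K × n ^ 19 ≤ 2 ^ (10 * ∣ K ∣) ×
    (∀ v → v ∉ Y → Σ (Fin n) λ u → u ∈ K × adj G v u ≡ false)

-- Suppose c is a clique colouring of G with k ≤ (1/2000) log₂ n colours. Grow a set S from ∅ and
-- watch the colour classes of T(S), the set of vertices outside S with no neighbour in S. While
-- |S| ≤ k, Property 1 and pigeonhole give a class Y of T(S) with at least n^0.999 vertices. If some
-- vertex has fewer than n^0.999 non-neighbours in Y, add it to S: this makes the class of that
-- colour small for good, so |S| never exceeds k. Otherwise Y is significant by Property 2, so by
-- Property 3 it contains a clique which extends, inside Y, to a maximal clique of G; that clique is
-- monochromatic, a contradiction.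
module Submission where

open import Defs hiding (sym)
open import Data.Nat using (ℕ; zero; suc; _+_; _*_; _^_; _≤_; _<_; _≡ᵇ_; z≤n; s≤s; s≤s⁻¹; _≤?_; _<?_)
open import Data.Nat.Properties
open import Data.Bool using (Bool; true; false; not; _∧_; T) renaming (_≟_ to _≟ᵇ_)
open import Data.Bool.Properties using (T-≡; T-not-≡; T-∧)
open import Data.Fin using (Fin; fromℕ<; toℕ) renaming (_≟_ to _≟ᶠ_)
open import Data.Fin.Properties using (any?; all?; toℕ<n)
open import Data.Fin.Subset renaming (⊥ to ∅)
open import Data.Fin.Subset.Properties
open import Data.List as List using (List; []; _∷_; length)
open import Data.List.Properties using (length-tabulate)
open import Data.List.Relation.Unary.All using (All; []; _∷_)
open import Data.List.Relation.Unary.All.Properties using (tabulate⁺)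
open import Data.List.Relation.Unary.Any using (here; there)
open import Data.List.Membership.Propositional using () renaming (_∈_ to _∈ˡ_)
open import Data.List.Membership.Propositional.Properties using (∈-tabulate⁺)
open import Data.List.Extrema.Nat using (argmax; argmax-all; f[xs]≤f[argmax])
open import Data.Vec using (lookup; tabulate; []; _∷_)
open import Data.Vec.Properties using (lookup∘tabulate; []=⇒lookup; lookup⇒[]=)
open import Data.Product using (Σ; ∃; _×_; _,_; proj₁; proj₂)
open import Data.Sum using (inj₁; inj₂)
open import Data.Empty using (⊥; ⊥-elim)
open import Function using (_∘′_)
open import Function.Bundles using (Equivalence)
open import Relation.Unary using (Pred; Decidable)
open import Relation.Nullary using (¬_; yes; no; ¬?; _×-dec_; _→-dec_)
open import Relation.Nullary.Decidable using (⌊_⌋; fromWitness; toWitness; decidable-stable)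
open import Relation.Binary.PropositionalEquality
open import Algebra.Properties.CommutativeSemigroup *-commutativeSemigroup using (interchange; xy∙z≈xz∙y)

private
  variable
    n k : ℕ

x∈tabulate⁺ : {f : Fin n → Bool} {x : Fin n} → T (f x) → x ∈ tabulate f
x∈tabulate⁺ {f = f} {x} fx =
  lookup⇒[]= x (tabulate f) (trans (lookup∘tabulate f x) (Equivalence.to T-≡ fx))

x∈tabulate⁻ : {f : Fin n → Bool} {x : Fin n} → x ∈ tabulate f → T (f x)
x∈tabulate⁻ {f = f} {x} x∈ =
  Equivalence.from T-≡ (trans (sym (lookup∘tabulate f x)) ([]=⇒lookup x∈))

setOf : ∀ {p} {P : Pred (Fin n) p} → Decidable P → Subset n
setOf P? = tabulate (λ x → ⌊ P? x ⌋)

module _ {p} {P : Pred (Fin n) p} {P? : Decidable P} {x : Fin n} where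

  x∈setOf⁺ : P x → x ∈ setOf P?
  x∈setOf⁺ px = x∈tabulate⁺ (fromWitness px)

  x∈setOf⁻ : x ∈ setOf P? → P x
  x∈setOf⁻ x∈ = toWitness (x∈tabulate⁻ x∈)

x∈p⇒1≤∣p∣ : {p : Subset n} {x : Fin n} → x ∈ p → 1 ≤ ∣ p ∣
x∈p⇒1≤∣p∣ x∈p = ≤-trans (s≤s z≤n) (x∈p⇒∣p-x∣<∣p∣ x∈p)

x,y∈p⇒2≤∣p∣ : {p : Subset n} {x y : Fin n} → x ∈ p → y ∈ p → x ≢ y → 2 ≤ ∣ p ∣
x,y∈p⇒2≤∣p∣ x∈p y∈p x≢y =
  ≤-trans (s≤s (x∈p⇒1≤∣p∣ (x∈p∧x≢y⇒x∈p-y y∈p (x≢y ∘′ sym)))) (x∈p⇒∣p-x∣<∣p∣ x∈p)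

p∪⁅x⁆⊆r : {p r : Subset n} {x : Fin n} → p ⊆ r → x ∈ r → p ∪ ⁅ x ⁆ ⊆ r
p∪⁅x⁆⊆r {p = p} {x = x} p⊆r x∈r y∈ with x∈p∪q⁻ p ⁅ x ⁆ y∈
... | inj₁ y∈p = p⊆r y∈p
... | inj₂ y∈x rewrite x∈⁅y⁆⇒x≡y x y∈x = x∈r

∣p∪q∣≤∣p∣+∣q∣ : (p q : Subset n) → ∣ p ∪ q ∣ ≤ ∣ p ∣ + ∣ q ∣
∣p∪q∣≤∣p∣+∣q∣ []           []           = z≤n
∣p∪q∣≤∣p∣+∣q∣ (true  ∷ p)  (true  ∷ q)  = s≤s (≤-trans (∣p∪q∣≤∣p∣+∣q∣ p q) (+-monoʳ-≤ ∣ p ∣ (n≤1+n ∣ q ∣)))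
∣p∪q∣≤∣p∣+∣q∣ (true  ∷ p)  (false ∷ q)  = s≤s (∣p∪q∣≤∣p∣+∣q∣ p q)
∣p∪q∣≤∣p∣+∣q∣ (false ∷ p)  (true  ∷ q)  = ≤-trans (s≤s (∣p∪q∣≤∣p∣+∣q∣ p q)) (≤-reflexive (sym (+-suc ∣ p ∣ ∣ q ∣)))
∣p∪q∣≤∣p∣+∣q∣ (false ∷ p)  (false ∷ q)  = ∣p∪q∣≤∣p∣+∣q∣ p q

∣⋃qs∣≤length*t : ∀ t (qs : List (Subset n)) → All (λ q → ∣ q ∣ ≤ t) qs → ∣ ⋃ qs ∣ ≤ length qs * t
∣⋃qs∣≤length*t {n} t []       []          = ≤-reflexive (∣⊥∣≡0 n)
∣⋃qs∣≤length*t     t (q ∷ qs) (q≤t ∷ qs≤t) =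
  ≤-trans (∣p∪q∣≤∣p∣+∣q∣ q (⋃ qs)) (+-mono-≤ q≤t (∣⋃qs∣≤length*t t qs qs≤t))

x∈q∈qs⇒x∈⋃qs : {x : Fin n} {q : Subset n} {qs : List (Subset n)} → x ∈ q → q ∈ˡ qs → x ∈ ⋃ qs
x∈q∈qs⇒x∈⋃qs x∈q (here refl) = x∈p∪q⁺ (inj₁ x∈q)
x∈q∈qs⇒x∈⋃qs x∈q (there q∈qs) = x∈p∪q⁺ (inj₂ (x∈q∈qs⇒x∈⋃qs x∈q q∈qs))

colourClass : (Fin n → Fin k) → Fin k → Subset n
colourClass c i = setOf (λ v → c v ≟ᶠ i)

x∈colourClass⁺ : (c : Fin n → Fin k) (x : Fin n) → x ∈ colourClass c (c x)
x∈colourClass⁺ c x = x∈setOf⁺ {P? = λ v → c v ≟ᶠ c x} refl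

x∈colourClass⁻ : (c : Fin n → Fin k) {i : Fin k} {x : Fin n} → x ∈ colourClass c i → c x ≡ i
x∈colourClass⁻ c {i} = x∈setOf⁻ {P? = λ v → c v ≟ᶠ i}

colourClasses : (Fin n → Fin k) → Subset n → List (Subset n)
colourClasses c p = List.tabulate (λ i → p ∩ colourClass c i)

∣p∣≤k*t : ∀ (c : Fin n → Fin k) p t → All (λ q → ∣ q ∣ ≤ t) (colourClasses c p) → ∣ p ∣ ≤ k * t
∣p∣≤k*t {k = k} c p t classes≤t = begin
  ∣ p ∣                              ≤⟨ p⊆q⇒∣p∣≤∣q∣ p⊆⋃classes ⟩
  ∣ ⋃ (colourClasses c p) ∣          ≤⟨ ∣⋃qs∣≤length*t t _ classes≤t ⟩
  length (colourClasses c p) * t     ≡⟨ cong (_* t) (length-tabulate (λ i → p ∩ colourClass c i)) ⟩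
  k * t                              ∎
  where
  open ≤-Reasoning
  p⊆⋃classes : p ⊆ ⋃ (colourClasses c p)
  p⊆⋃classes {x} x∈p = x∈q∈qs⇒x∈⋃qs (x∈p∩q⁺ (x∈p , x∈colourClass⁺ c x)) (∈-tabulate⁺ (c x))

^-distribʳ-* : ∀ x y e → (x * y) ^ e ≡ x ^ e * y ^ e
^-distribʳ-* x y zero    = refl
^-distribʳ-* x y (suc e) = begin
  x * y * (x * y) ^ e       ≡⟨ cong (x * y *_) (^-distribʳ-* x y e) ⟩
  x * y * (x ^ e * y ^ e)   ≡⟨ interchange x y (x ^ e) (y ^ e) ⟩
  x * x ^ e * (y * y ^ e)   ∎
  where open ≡-Reasoning

2^2000k≤n⇒2≤n : ∀ {n} k → 1 ≤ k → 2 ^ (2000 * k) ≤ n → 2 ≤ n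
2^2000k≤n⇒2≤n k 1≤k big = ≤-trans (^-monoʳ-≤ 2 (≤-trans 1≤k (m≤n*m k 2000))) big

2≤n⇒moreThan⇒n^999<m^1000 : ∀ {n} m → 2 ≤ n → MoreThanN999LogN n m → n ^ 999 < m ^ 1000
2≤n⇒moreThan⇒n^999<m^1000 {n} m 2≤n (a , b , _ , n^b<2^a , a^1000n^999<m^1000b^1000) =
  *-cancelʳ-< (b ^ 1000) (n ^ 999) (m ^ 1000) (begin-strict
    n ^ 999 * b ^ 1000   ≤⟨ *-monoʳ-≤ (n ^ 999) (^-monoˡ-≤ 1000 (<⇒≤ b<a)) ⟩
    n ^ 999 * a ^ 1000   ≡⟨ *-comm (n ^ 999) (a ^ 1000) ⟩
    a ^ 1000 * n ^ 999   <⟨ a^1000n^999<m^1000b^1000 ⟩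
    m ^ 1000 * b ^ 1000  ∎)
  where
  open ≤-Reasoning
  b<a : b < a
  b<a = ≰⇒> λ a≤b → <-irrefl refl (<-≤-trans n^b<2^a (begin
    2 ^ a  ≤⟨ ^-monoʳ-≤ 2 a≤b ⟩
    2 ^ b  ≤⟨ ^-monoˡ-≤ b 2≤n ⟩
    n ^ b  ∎))

≤k*t⇒¬moreThan : ∀ {n} k t m → 2 ^ (2000 * k) ≤ n → t ^ 1000 ≤ n ^ 999 → m ≤ k * t →
  ¬ MoreThanN999LogN n m
≤k*t⇒¬moreThan {n} k t m big t^1000≤n^999 m≤kt (a , b , _ , n^b<2^a , a^1000n^999<m^1000b^1000) =
  <-irrefl refl (<-≤-trans n^b<2^a (begin
    2 ^ a                 ≤⟨ ^-monoʳ-≤ 2 (≤-trans (<⇒≤ a<kb) (*-monoˡ-≤ b (m≤n*m k 2000))) ⟩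
    2 ^ (2000 * k * b)    ≡⟨ sym (^-*-assoc 2 (2000 * k) b) ⟩
    (2 ^ (2000 * k)) ^ b  ≤⟨ ^-monoˡ-≤ b big ⟩
    n ^ b                 ∎))
  where
  open ≤-Reasoning
  a<kb : a < k * b
  a<kb = ≰⇒> λ kb≤a → <-irrefl refl (begin-strict
    (k * b) ^ 1000 * n ^ 999              ≤⟨ *-monoˡ-≤ (n ^ 999) (^-monoˡ-≤ 1000 kb≤a) ⟩
    a ^ 1000 * n ^ 999                    <⟨ a^1000n^999<m^1000b^1000 ⟩
    m ^ 1000 * b ^ 1000                   ≤⟨ *-monoˡ-≤ (b ^ 1000) (^-monoˡ-≤ 1000 m≤kt) ⟩
    (k * t) ^ 1000 * b ^ 1000             ≡⟨ cong (_* b ^ 1000) (^-distribʳ-* k t 1000) ⟩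
    k ^ 1000 * t ^ 1000 * b ^ 1000        ≡⟨ xy∙z≈xz∙y (k ^ 1000) (t ^ 1000) (b ^ 1000) ⟩
    k ^ 1000 * b ^ 1000 * t ^ 1000        ≤⟨ *-monoʳ-≤ (k ^ 1000 * b ^ 1000) t^1000≤n^999 ⟩
    k ^ 1000 * b ^ 1000 * n ^ 999         ≡⟨ cong (_* n ^ 999) (sym (^-distribʳ-* k b 1000)) ⟩
    (k * b) ^ 1000 * n ^ 999              ∎)

2≤n⇒n^19≤2^10m⇒2≤m : ∀ {n} m → 2 ≤ n → n ^ 19 ≤ 2 ^ (10 * m) → 2 ≤ m
2≤n⇒n^19≤2^10m⇒2≤m {n} m 2≤n n^19≤2^10m = ≰⇒> λ m≤1 → <-irrefl refl (begin-strict
  2 ^ 10          <⟨ ^-monoʳ-< 2 ≤-refl {10} {19} (m≤m+n 11 8) ⟩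
  2 ^ 19          ≤⟨ ^-monoˡ-≤ 19 2≤n ⟩
  n ^ 19          ≤⟨ n^19≤2^10m ⟩
  2 ^ (10 * m)    ≤⟨ ^-monoʳ-≤ 2 (*-monoʳ-≤ 10 m≤1) ⟩
  2 ^ 10          ∎)
  where open ≤-Reasoning

∣p∣≡0⇒x∉p : {p : Subset n} {x : Fin n} → ∣ p ∣ ≡ 0 → x ∉ p
∣p∣≡0⇒x∉p ∣p∣≡0 x∈p = <-irrefl refl (≤-trans (x∈p⇒1≤∣p∣ x∈p) (≤-reflexive ∣p∣≡0))

Empty⇒∣p∣≡0 : {p : Subset n} → Empty p → ∣ p ∣ ≡ 0
Empty⇒∣p∣≡0 {n} empty = trans (cong ∣_∣ (Empty-unique empty)) (∣⊥∣≡0 n)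

x∉p⇒lookup≡false : {p : Subset n} {x : Fin n} → x ∉ p → lookup p x ≡ false
x∉p⇒lookup≡false {p = p} {x} x∉p with lookup p x in eq
... | true  = ⊥-elim (x∉p (lookup⇒[]= x p eq))
... | false = refl

lookup≡false⇒x∉p : {p : Subset n} {x : Fin n} → lookup p x ≡ false → x ∉ p
lookup≡false⇒x∉p eq x∈p with trans (sym ([]=⇒lookup x∈p)) eq
... | ()

module _ {n} (G : Graph n) where

  commonNonNbrs : Subset n → Subset n
  commonNonNbrs S = tabulate (λ v → not (lookup S v) ∧ (nbrsIn G S v ≡ᵇ 0))

  NonAdjacentTo : Fin n → Subset n → Set
  NonAdjacentTo v S = ∀ {u} → u ∈ S → adj G v u ≡ false

  nbrsIn≡0⇒NonAdjacentTo : ∀ {S v} → nbrsIn G S v ≡ 0 → NonAdjacentTo v S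
  nbrsIn≡0⇒NonAdjacentTo {S} {v} none {u} u∈S with adj G v u in vu
  ... | false = refl
  ... | true  = ⊥-elim (∣p∣≡0⇒x∉p {p = tabulate (λ w → lookup S w ∧ adj G v w)} none (x∈tabulate⁺ (subst₂ (λ a b → T (a ∧ b)) (sym ([]=⇒lookup u∈S)) (sym vu) _)))

  NonAdjacentTo⇒nbrsIn≡0 : ∀ {S v} → NonAdjacentTo v S → nbrsIn G S v ≡ 0
  NonAdjacentTo⇒nbrsIn≡0 {S} {v} nonAdj = Empty⇒∣p∣≡0 λ where
    (u , u∈) → let (Su , vu) = Equivalence.to T-∧ (x∈tabulate⁻ u∈) in
      subst T (nonAdj (lookup⇒[]= u S (Equivalence.to T-≡ Su))) vu

  x∈commonNonNbrs⁻ : ∀ S {v} → v ∈ commonNonNbrs S → v ∉ S × NonAdjacentTo v S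
  x∈commonNonNbrs⁻ S {v} v∈ =
    let (v∉S , none) = Equivalence.to T-∧ (x∈tabulate⁻ v∈) in
    lookup≡false⇒x∉p (Equivalence.to T-not-≡ v∉S) ,
    nbrsIn≡0⇒NonAdjacentTo (≡ᵇ⇒≡ (nbrsIn G S v) 0 none)

  x∈commonNonNbrs⁺ : ∀ S {v} → v ∉ S → NonAdjacentTo v S → v ∈ commonNonNbrs S
  x∈commonNonNbrs⁺ S {v} v∉S nonAdj = x∈tabulate⁺ (Equivalence.from T-∧
    ( Equivalence.from T-not-≡ (x∉p⇒lookup≡false v∉S)
    , ≡⇒≡ᵇ (nbrsIn G S v) 0 (NonAdjacentTo⇒nbrsIn≡0 nonAdj)))

  commonNonNbrs-antitone : ∀ {S S′} → S ⊆ S′ → commonNonNbrs S′ ⊆ commonNonNbrs S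
  commonNonNbrs-antitone {S} {S′} S⊆S′ v∈ =
    let (v∉S′ , nonAdj) = x∈commonNonNbrs⁻ S′ v∈ in
    x∈commonNonNbrs⁺ S (λ v∈S → v∉S′ (S⊆S′ v∈S)) (λ u∈S → nonAdj (S⊆S′ u∈S))

  ∣p∣≤nonNbrsIn : ∀ p Y v → (∀ {u} → u ∈ p → u ∈ Y × adj G v u ≡ false) → ∣ p ∣ ≤ nonNbrsIn G Y v
  ∣p∣≤nonNbrsIn p Y v p⊆ = p⊆q⇒∣p∣≤∣q∣ λ {u} u∈p →
    let (u∈Y , vu) = p⊆ u∈p in
    x∈tabulate⁺ (subst₂ (λ a b → T (a ∧ not b)) (sym ([]=⇒lookup u∈Y)) (sym vu) _)

  OutsideHasNonNbrIn : Subset n → Subset n → Set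
  OutsideHasNonNbrIn Y K = ∀ v → v ∉ Y → Σ (Fin n) λ u → u ∈ K × adj G v u ≡ false

  Addable : Subset n → Subset n → Fin n → Set
  Addable Y K w = w ∈ Y × w ∉ K × (∀ u → u ∈ K → adj G w u ≡ true)

  addable? : ∀ Y K → Decidable (Addable Y K)
  addable? Y K w = w ∈? Y ×-dec ¬? (w ∈? K) ×-dec all? (λ u → u ∈? K →-dec adj G w u ≟ᵇ true)

  IsClique-∪⁅⁆ : ∀ {K w} → IsClique G K → (∀ u → u ∈ K → adj G w u ≡ true) → IsClique G (K ∪ ⁅ w ⁆)
  IsClique-∪⁅⁆ {K} {w} clK wK u v u∈ v∈ u≢v with x∈p∪q⁻ K ⁅ w ⁆ u∈ | x∈p∪q⁻ K ⁅ w ⁆ v∈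
  ... | inj₁ u∈K | inj₁ v∈K = clK u v u∈K v∈K u≢v
  ... | inj₁ u∈K | inj₂ v∈w rewrite x∈⁅y⁆⇒x≡y w v∈w = trans (Graph.sym G u w) (wK u u∈K)
  ... | inj₂ u∈w | inj₁ v∈K rewrite x∈⁅y⁆⇒x≡y w u∈w = wK v v∈K
  ... | inj₂ u∈w | inj₂ v∈w = ⊥-elim (u≢v (trans (x∈⁅y⁆⇒x≡y w u∈w) (sym (x∈⁅y⁆⇒x≡y w v∈w))))

  saturated⇒maximal : ∀ {Y K} → IsClique G K → OutsideHasNonNbrIn Y K → ¬ ∃ (Addable Y K) →
    IsMaximalClique G K
  saturated⇒maximal {Y} {K} clK blocked saturated = clK , extends
    where
    extends : ∀ K′ → IsClique G K′ → K ⊆ K′ → K′ ⊆ K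
    extends K′ clK′ K⊆K′ {x} x∈K′ with x ∈? K | x ∈? Y
    ... | yes x∈K | _     = x∈K
    ... | no x∉K  | yes x∈Y =
      ⊥-elim (saturated (x , x∈Y , x∉K , λ u u∈K → clK′ x u x∈K′ (K⊆K′ u∈K) (x≢ u∈K)))
      where x≢ : ∀ {u} → u ∈ K → x ≢ u
            x≢ u∈K refl = x∉K u∈K
    ... | no x∉K  | no x∉Y  with blocked x x∉Y
    ...   | u , u∈K , xu with trans (sym xu) (clK′ x u x∈K′ (K⊆K′ u∈K) λ { refl → x∉K u∈K })
    ...     | ()

  extend-to-maximal-clique : ∀ {Y K} → K ⊆ Y → IsClique G K → OutsideHasNonNbrIn Y K →
    Σ (Subset n) λ K′ → K ⊆ K′ × K′ ⊆ Y × IsMaximalClique G K′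
  extend-to-maximal-clique {Y} {K} = grow n (m≤m+n n ∣ K ∣)
    where
    grow : ∀ fuel {K} → n ≤ fuel + ∣ K ∣ → K ⊆ Y → IsClique G K → OutsideHasNonNbrIn Y K →
      Σ (Subset n) λ K′ → K ⊆ K′ × K′ ⊆ Y × IsMaximalClique G K′
    grow fuel {K} n≤ K⊆Y clK blocked with any? (addable? Y K)
    ... | no saturated = K , ⊆-refl , K⊆Y , saturated⇒maximal clK blocked saturated
    ... | yes (w , w∈Y , w∉K , wK) = add fuel n≤ (p⊂q⇒∣p∣<∣q∣ K⊂K+w)
      where
      K⊂K+w : K ⊂ K ∪ ⁅ w ⁆
      K⊂K+w = p⊆p∪q ⁅ w ⁆ , w , x∈p∪q⁺ (inj₂ (x∈⁅x⁆ w)) , w∉K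
      add : ∀ fuel → n ≤ fuel + ∣ K ∣ → ∣ K ∣ < ∣ K ∪ ⁅ w ⁆ ∣ →
        Σ (Subset n) λ K′ → K ⊆ K′ × K′ ⊆ Y × IsMaximalClique G K′
      add zero n≤ ∣K∣<∣K+w∣ =
        ⊥-elim (<-irrefl refl (<-≤-trans ∣K∣<∣K+w∣ (≤-trans (∣p∣≤n (K ∪ ⁅ w ⁆)) n≤)))
      add (suc fuel) n≤ ∣K∣<∣K+w∣ =
        let (K′ , K+w⊆K′ , K′⊆Y , maxK′) = grow fuel (≤-trans n≤ (+-monoʳ-< fuel ∣K∣<∣K+w∣))
              (p∪⁅x⁆⊆r K⊆Y w∈Y) (IsClique-∪⁅⁆ clK wK)
              (λ v v∉Y → let (u , u∈K , vu) = blocked v v∉Y in u , p⊆p∪q ⁅ w ⁆ u∈K , vu)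
        in K′ , ⊆-trans (p⊆p∪q ⁅ w ⁆) K+w⊆K′ , K′⊆Y , maxK′

  IsClique-⁅⁆ : ∀ u → IsClique G ⁅ u ⁆
  IsClique-⁅⁆ u v w v∈ w∈ v≢w =
    ⊥-elim (v≢w (trans (x∈⁅y⁆⇒x≡y u v∈) (sym (x∈⁅y⁆⇒x≡y u w∈))))

  edge⇒maximal-clique : ∀ {u w} → adj G u w ≡ true →
    Σ (Subset n) λ K → u ∈ K × w ∈ K × u ≢ w × IsMaximalClique G K
  edge⇒maximal-clique {u} {w} uw =
    let (K , u,w∈K , _ , maxK) = extend-to-maximal-clique {Y = ⊤} ⊆⊤
          (IsClique-∪⁅⁆ (IsClique-⁅⁆ u) λ x x∈ → trans (cong (adj G w) (x∈⁅y⁆⇒x≡y u x∈)) (trans (Graph.sym G w u) uw))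
          (λ v v∉⊤ → ⊥-elim (v∉⊤ ∈⊤))
    in K , u,w∈K (x∈p∪q⁺ (inj₁ (x∈⁅x⁆ u))) , u,w∈K (x∈p∪q⁺ (inj₂ (x∈⁅x⁆ w))) , u≢w , maxK
    where
    u≢w : u ≢ w
    u≢w refl with trans (sym uw) (Graph.irrefl G u)
    ... | ()

clique-colouring⇒¬monochromatic : ∀ {G : Graph n} {c : Fin n → Fin k} {K i} → IsCliqueColoring G c →
  IsMaximalClique G K → 2 ≤ ∣ K ∣ → ¬ (∀ u → u ∈ K → c u ≡ i)
clique-colouring⇒¬monochromatic {K = K} col maxK 2≤∣K∣ mono =
  let (u , v , u∈K , v∈K , cu≢cv) = col K maxK 2≤∣K∣ in
  cu≢cv (trans (mono u u∈K) (sym (mono v v∈K)))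

-- Sets are passed explicitly below: inferring them through ∣_∣ ^ 1000 would make Agda unfold
-- thousand-fold products.
module _ {n k} (G : Graph n) (c : Fin n → Fin k)
         (P1 : Property1 G) (P2 : Property2 G) (P3 : Property3 G)
         (col : IsCliqueColoring G c) (big : 2 ^ (2000 * k) ≤ n) where

  1≤k : Fin k → 1 ≤ k
  1≤k i = ≤-trans (s≤s z≤n) (toℕ<n i)

  2≤n : Fin k → 2 ≤ n
  2≤n i = 2^2000k≤n⇒2≤n k (1≤k i) big

  ∣S∣≤k⇒2^2000∣S∣≤n : ∀ (S : Subset n) → ∣ S ∣ ≤ k → 2 ^ (2000 * ∣ S ∣) ≤ n
  ∣S∣≤k⇒2^2000∣S∣≤n S ∣S∣≤k = ≤-trans (^-monoʳ-≤ 2 (*-monoʳ-≤ 2000 ∣S∣≤k)) big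

  ¬significant-monochromatic : ∀ Y {i} → Significant G Y → ¬ (∀ u → u ∈ Y → c u ≡ i)
  ¬significant-monochromatic Y {i} sig mono =
    let (K , K⊆Y , clK , n^19≤2^10∣K∣ , blocked) = P3 Y sig
        (K′ , K⊆K′ , K′⊆Y , maxK′) = extend-to-maximal-clique G K⊆Y clK blocked
    in clique-colouring⇒¬monochromatic {G = G} {c = c} col maxK′
         (≤-trans (2≤n⇒n^19≤2^10m⇒2≤m ∣ K ∣ (2≤n i) n^19≤2^10∣K∣) (p⊆q⇒∣p∣≤∣q∣ K⊆K′))
         (λ u u∈K′ → mono u (K′⊆Y u∈K′))

  -- With a single colour the graph is edgeless, so Y = V ∖ {v₀} is significant and monochromatic.
  ¬constant : ∀ i → ¬ (∀ v → c v ≡ i)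
  ¬constant i const = ¬significant-monochromatic Y sig (λ u _ → const u)
    where
    edgeless : ∀ u w → adj G u w ≡ false
    edgeless u w with adj G u w in uw
    ... | false = refl
    ... | true  = let (K , u∈K , w∈K , u≢w , maxK) = edge⇒maximal-clique G uw in
      ⊥-elim (clique-colouring⇒¬monochromatic {G = G} {c = c} col maxK
        (x,y∈p⇒2≤∣p∣ u∈K w∈K u≢w) (λ v _ → const v))
    v₀ : Fin n
    v₀ = fromℕ< {1} (2≤n i)
    Y : Subset n
    Y = commonNonNbrs G ⁅ v₀ ⁆
    v₀∉Y : v₀ ∉ Y
    v₀∉Y v₀∈Y = proj₁ (x∈commonNonNbrs⁻ G ⁅ v₀ ⁆ v₀∈Y) (x∈⁅x⁆ v₀)
    outside⇒≡v₀ : ∀ v → v ∉ Y → v ≡ v₀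
    outside⇒≡v₀ v v∉Y with v ≟ᶠ v₀
    ... | yes v≡v₀ = v≡v₀
    ... | no  v≢v₀ = ⊥-elim (v∉Y (x∈commonNonNbrs⁺ G ⁅ v₀ ⁆ (x≢y⇒x∉⁅y⁆ v≢v₀) (λ _ → edgeless v _)))
    large : n ^ 999 < ∣ Y ∣ ^ 1000
    large = 2≤n⇒moreThan⇒n^999<m^1000 ∣ Y ∣ (2≤n i)
      (P1 ⁅ v₀ ⁆ (∣S∣≤k⇒2^2000∣S∣≤n ⁅ v₀ ⁆ (≤-trans (≤-reflexive (∣⁅x⁆∣≡1 v₀)) (1≤k i))))
    manyNonNbrs : ∀ v → v ∉ Y → n ^ 999 ≤ nonNbrsIn G Y v ^ 1000
    manyNonNbrs v v∉Y = subst (λ x → n ^ 999 ≤ nonNbrsIn G Y x ^ 1000) (sym (outside⇒≡v₀ v v∉Y))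
      (≤-trans (<⇒≤ large) (^-monoˡ-≤ 1000 (∣p∣≤nonNbrsIn G Y Y v₀ (λ u∈Y → u∈Y , edgeless v₀ _))))
    sig : Significant G Y
    sig = (v₀ , v₀∉Y) , manyNonNbrs , <⇒≤ (P2 Y (<⇒≤ large))

  nonNbrClass : Subset n → Fin k → Subset n
  nonNbrClass S i = commonNonNbrs G S ∩ colourClass c i

  x∈nonNbrClass⁻ : ∀ S i {x} → x ∈ nonNbrClass S i → x ∈ commonNonNbrs G S × c x ≡ i
  x∈nonNbrClass⁻ S i x∈ =
    let (x∈T , x∈i) = x∈p∩q⁻ (commonNonNbrs G S) (colourClass c i) x∈ in x∈T , x∈colourClass⁻ c x∈i

  nonNbrClass-antitone : ∀ {S S′} i → S ⊆ S′ → nonNbrClass S′ i ⊆ nonNbrClass S i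
  nonNbrClass-antitone {S} {S′} i S⊆S′ v∈ =
    let (v∈T , v∈i) = x∈p∩q⁻ (commonNonNbrs G S′) (colourClass c i) v∈ in
    x∈p∩q⁺ (commonNonNbrs-antitone G S⊆S′ v∈T , v∈i)

  IsLargeColour : Subset n → Fin k → Set
  IsLargeColour S i = n ^ 999 ≤ ∣ nonNbrClass S i ∣ ^ 1000

  isLargeColour? : ∀ S → Decidable (IsLargeColour S)
  isLargeColour? S i = n ^ 999 ≤? ∣ nonNbrClass S i ∣ ^ 1000

  largeColours : Subset n → Subset k
  largeColours S = setOf (isLargeColour? S)

  x∈largeColours⁺ : ∀ S i → IsLargeColour S i → i ∈ largeColours S
  x∈largeColours⁺ S i = x∈setOf⁺ {P? = isLargeColour? S}

  x∈largeColours⁻ : ∀ S i → i ∈ largeColours S → IsLargeColour S i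
  x∈largeColours⁻ S i = x∈setOf⁻ {P? = isLargeColour? S}

  largeColours-antitone : ∀ {S S′} → S ⊆ S′ → largeColours S′ ⊆ largeColours S
  largeColours-antitone {S} {S′} S⊆S′ {i} i∈ =
    x∈largeColours⁺ S i (≤-trans (x∈largeColours⁻ S′ i i∈)
      (^-monoˡ-≤ 1000 (p⊆q⇒∣p∣≤∣q∣ (nonNbrClass-antitone i S⊆S′))))

  -- Adding a vertex v to S confines the class of i to the non-neighbours of v in it.
  largeColours-shrink : ∀ S i v → i ∈ largeColours S →
    nonNbrsIn G (nonNbrClass S i) v ^ 1000 < n ^ 999 → largeColours (S ∪ ⁅ v ⁆) ⊂ largeColours S
  largeColours-shrink S i v i∈ few =
    largeColours-antitone {S} {S′} (p⊆p∪q ⁅ v ⁆) , i , i∈ , λ i∈′ → <-irrefl refl (begin-strict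
      n ^ 999                                  ≤⟨ x∈largeColours⁻ S′ i i∈′ ⟩
      ∣ nonNbrClass S′ i ∣ ^ 1000              ≤⟨ ^-monoˡ-≤ 1000 ∣class′∣≤nonNbrs ⟩
      nonNbrsIn G (nonNbrClass S i) v ^ 1000   <⟨ few ⟩
      n ^ 999                                  ∎)
    where
    open ≤-Reasoning
    S′ : Subset n
    S′ = S ∪ ⁅ v ⁆
    nonNbrs : ∀ {u} → u ∈ nonNbrClass S′ i → u ∈ nonNbrClass S i × adj G v u ≡ false
    nonNbrs {u} u∈ =
      nonNbrClass-antitone {S} {S′} i (p⊆p∪q ⁅ v ⁆) u∈ ,
      trans (Graph.sym G v u) (proj₂ (x∈commonNonNbrs⁻ G S′ (proj₁ (x∈nonNbrClass⁻ S′ i u∈)))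
        (x∈p∪q⁺ {p = S} (inj₂ (x∈⁅x⁆ v))))
    ∣class′∣≤nonNbrs : ∣ nonNbrClass S′ i ∣ ≤ nonNbrsIn G (nonNbrClass S i) v
    ∣class′∣≤nonNbrs = ∣p∣≤nonNbrsIn G (nonNbrClass S′ i) (nonNbrClass S i) v nonNbrs

  classesOf : Subset n → List (Subset n)
  classesOf S = colourClasses c (commonNonNbrs G S)

  largestClass : Subset n → Subset n
  largestClass S = argmax ∣_∣ ∅ (classesOf S)

  largestClass-small : ∀ S → Empty (largeColours S) → ∣ largestClass S ∣ ^ 1000 ≤ n ^ 999
  largestClass-small S empty = argmax-all ∣_∣ {P = λ q → ∣ q ∣ ^ 1000 ≤ n ^ 999} {∅} {classesOf S}
    (subst (λ z → z ^ 1000 ≤ n ^ 999) (sym (∣⊥∣≡0 n)) z≤n)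
    (tabulate⁺ λ i → ≮⇒≥ λ large → empty (i , x∈largeColours⁺ S i (<⇒≤ large)))

  -- Pigeonhole: otherwise |T(S)| ≤ k·n^0.999, contradicting Property 1.
  some-colour-large : ∀ S → ∣ S ∣ ≤ k → Nonempty (largeColours S)
  some-colour-large S ∣S∣≤k = decidable-stable (nonempty? (largeColours S)) λ empty →
    ≤k*t⇒¬moreThan k ∣ largestClass S ∣ ∣ commonNonNbrs G S ∣ big (largestClass-small S empty)
      (∣p∣≤k*t c (commonNonNbrs G S) ∣ largestClass S ∣ (f[xs]≤f[argmax] ∅ (classesOf S)))
      (P1 S (∣S∣≤k⇒2^2000∣S∣≤n S ∣S∣≤k))

  poor-vertex : ∀ S i → i ∈ largeColours S → ∃ λ v → nonNbrsIn G (nonNbrClass S i) v ^ 1000 < n ^ 999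
  poor-vertex S i i∈ = decidable-stable (any? λ v → nonNbrsIn G Y v ^ 1000 <? n ^ 999) λ nonePoor →
    ¬significant-monochromatic Y
      ( decidable-stable (any? λ v → ¬? (v ∈? Y)) (λ noneOutside →
          ¬constant i λ v → colour (decidable-stable (v ∈? Y) λ v∉Y → noneOutside (v , v∉Y)))
      , (λ v _ → ≮⇒≥ λ poor → nonePoor (v , poor))
      , <⇒≤ (P2 Y (x∈largeColours⁻ S i i∈)))
      (λ u u∈Y → colour u∈Y)
    where
    Y : Subset n
    Y = nonNbrClass S i
    colour : ∀ {u} → u ∈ Y → c u ≡ i
    colour u∈Y = proj₂ (x∈nonNbrClass⁻ S i u∈Y)

  no-clique-colouring-from : ∀ m S → ∣ largeColours S ∣ ≤ m → ∣ S ∣ + m ≤ k → ⊥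
  no-clique-colouring-from zero S ≤0 ∣S∣≤k =
    let (i , i∈) = some-colour-large S (≤-trans (m≤m+n ∣ S ∣ 0) ∣S∣≤k) in
    1+n≰n (≤-trans (x∈p⇒1≤∣p∣ i∈) ≤0)
  no-clique-colouring-from (suc m) S ≤1+m ∣S∣+1+m≤k =
    let (i , i∈) = some-colour-large S (≤-trans (m≤m+n ∣ S ∣ (suc m)) ∣S∣+1+m≤k)
        (v , poor) = poor-vertex S i i∈
    in no-clique-colouring-from m (S ∪ ⁅ v ⁆)
         (s≤s⁻¹ (≤-trans (p⊂q⇒∣p∣<∣q∣ (largeColours-shrink S i v i∈ poor)) ≤1+m))
         (begin
           ∣ S ∪ ⁅ v ⁆ ∣ + m        ≤⟨ +-monoˡ-≤ m (∣p∪q∣≤∣p∣+∣q∣ S ⁅ v ⁆) ⟩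
           ∣ S ∣ + ∣ ⁅ v ⁆ ∣ + m    ≡⟨ cong (λ z → ∣ S ∣ + z + m) (∣⁅x⁆∣≡1 v) ⟩
           ∣ S ∣ + 1 + m            ≡⟨ +-assoc ∣ S ∣ 1 m ⟩
           ∣ S ∣ + suc m            ≤⟨ ∣S∣+1+m≤k ⟩
           k                        ∎)
    where open ≤-Reasoning

  no-clique-colouring : ⊥
  no-clique-colouring =
    no-clique-colouring-from k ∅ (∣p∣≤n (largeColours ∅)) (≤-reflexive (cong (_+ k) (∣⊥∣≡0 n)))

proposition3p1 : (n : ℕ) → 1 ≤ n → (G : Graph n) →
    Property1 G → Property2 G → Property3 G →
    (k : ℕ) (c : Fin n → Fin k) → IsCliqueColoring G c → n < 2 ^ (2000 * k)
proposition3p1 n _ G P1 P2 P3 k c col = decidable-stable (n <? 2 ^ (2000 * k)) λ n≮2^2000k →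
  no-clique-colouring G c P1 P2 P3 col (≮⇒≥ n≮2^2000k)
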